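{- Let $C$ be a quadratic circuit over $GF(2)$ computing the product $x\cdot y$ of two $n\times n$ matrices, with product gates computing $\mu_1(x,y)\eta_1(x,y),\dots,\mu_m(x,y)\eta_m(x,y)$ (the $\mu_k,\eta_k$ linear forms in the entries of $x$ and $y$), and suppose $(x\cdot y)_{i,j}=\sum_{k=1}^m\alpha^{(k)}_{i,j}\mu_k(x,y)\eta_k(x,y)$ with $\alpha^{(k)}_{i,j}\in\{0,1\}$ for all $i,j$. For an $n\times n$ matrix $z$ over $GF(2)$ let $\gamma_k(z)=\sum_{i,j}\alpha^{(k)}_{i,j}z_{i,j}$ and $\Gamma(z)=(\gamma_1(z),\dots,\gamma_m(z))\in GF(2)^m$. Then $\Gamma$ is linear and $\mathrm{weight}(\Gamma(z))\ge n\cdot\mathrm{rank}(z)$ for every $z\in M_n(GF(2))$.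
   Context: A quadratic circuit is an arithmetic circuit (directed acyclic graph of sum and product gates with field constants on edges) in which every product gate multiplies two linear forms in the input variables. $\mathrm{weight}(v)$ is the number of nonzero coordinates of $v$. -}

module Defs where

open import Data.Bool using (Bool; true; false; _∧_; _xor_; if_then_else_)
open import Data.Nat using (ℕ; zero; suc; _+_)
open import Data.Fin using (Fin; zero; suc)
open import Data.Fin.Properties using () renaming (_≟_ to _≟F_)
open import Data.Product using (_×_; _,_; Σ)
open import Data.Sum using (_⊎_; inj₁; inj₂)
open import Relation.Nullary.Decidable using (isYes)
open import Relation.Binary.PropositionalEquality using (_≡_)
open import Relation.Nullary using (¬_)

-- GF(2) is Bool with _xor_ as addition and _∧_ as multiplication.

Σ₂ : ∀ {k} → (Fin k → Bool) → Bool
Σ₂ {zero}  f = false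
Σ₂ {suc k} f = f zero xor Σ₂ (λ i → f (suc i))

weight : ∀ {m} → (Fin m → Bool) → ℕ
weight {zero}  v = 0
weight {suc m} v = (if v zero then 1 else 0) + weight (λ i → v (suc i))

Mat : ℕ → Set
Mat n = Fin n → Fin n → Bool

-- Input variables: entries x_{a,b} (inj₁ (a , b)) and y_{a,b} (inj₂ (a , b)).
Var : ℕ → Set
Var n = (Fin n × Fin n) ⊎ (Fin n × Fin n)

-- A linear form in the input variables (coefficient vector).
LinForm : ℕ → Set
LinForm n = Var n → Bool

eqFin : ∀ {n} → Fin n → Fin n → Bool
eqFin a b = isYes (a ≟F b)

eqVar : ∀ {n} → Var n → Var n → Bool
eqVar (inj₁ (a , b)) (inj₁ (c , d)) = eqFin a c ∧ eqFin b d
eqVar (inj₁ _)       (inj₂ _)       = false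
eqVar (inj₂ _)       (inj₁ _)       = false
eqVar (inj₂ (a , b)) (inj₂ (c , d)) = eqFin a c ∧ eqFin b d

-- Coefficient of the degree-2 monomial w_u w_v in the polynomial μ·η
-- (formal polynomial product; the monomial {u,v} is unordered).
coeffProd : ∀ {n} → LinForm n → LinForm n → Var n → Var n → Bool
coeffProd μ η u v =
  if eqVar u v then μ u ∧ η u else ((μ u ∧ η v) xor (μ v ∧ η u))

-- Coefficient of the monomial w_u w_v in the polynomial (x·y)_{i,j} = Σ_l x_{i,l} y_{l,j}.
coeffMatMul : ∀ {n} → Fin n → Fin n → Var n → Var n → Bool
coeffMatMul i j (inj₁ (a , b)) (inj₂ (c , d)) = eqFin a i ∧ eqFin b c ∧ eqFin d j
coeffMatMul i j (inj₂ (c , d)) (inj₁ (a , b)) = eqFin a i ∧ eqFin b c ∧ eqFin d j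
coeffMatMul i j (inj₁ _) (inj₁ _) = false
coeffMatMul i j (inj₂ _) (inj₂ _) = false

-- (x·y)_{i,j} = Σ_k α^{(k)}_{i,j} μ_k η_k as polynomials over GF(2):
-- all monomial coefficients agree (both sides are homogeneous quadratic).
ComputesMatMul : ∀ {n m} → (Fin m → LinForm n) → (Fin m → LinForm n) →
                 (Fin m → Mat n) → Set
ComputesMatMul {n} μ η α =
  ∀ (i j : Fin n) (u v : Var n) →
    Σ₂ (λ k → α k i j ∧ coeffProd (μ k) (η k) u v) ≡ coeffMatMul i j u v

Γ : ∀ {n m} → (Fin m → Mat n) → Mat n → Fin m → Bool
Γ α z k = Σ₂ (λ i → Σ₂ (λ j → α k i j ∧ z i j))

_⊕M_ : ∀ {n} → Mat n → Mat n → Mat n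
(z ⊕M w) i j = z i j xor w i j

_·M_ : ∀ {n} → Bool → Mat n → Mat n
(c ·M z) i j = c ∧ z i j

LinIndep : ∀ {n r} → (Fin r → Fin n → Bool) → Set
LinIndep {n} {r} v =
  ∀ (c : Fin r → Bool) →
    (∀ (j : Fin n) → Σ₂ (λ l → c l ∧ v l j) ≡ false) →
    ∀ (l : Fin r) → c l ≡ false

Rank : ∀ {n} → Mat n → ℕ → Set
Rank {n} z r =
  Σ (Fin r → Fin n) (λ ρ → LinIndep (λ l → z (ρ l))) ×
  (∀ (ρ : Fin (suc r) → Fin n) → ¬ LinIndep (λ l → z (ρ l)))

{-# OPTIONS --safe #-}

-- Let w = Γ(z). Summing the hypothesis against z shows that the quadratic polynomial
-- Σ_k w_k μ_k η_k equals Σ_{i,j} z_ij (x·y)_ij, so the two have the same polar (alternating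
-- bilinear) form B. Every row of B = Σ_k w_k (μ_k ⊗ η_k + η_k ⊗ μ_k) lies in the span of the
-- 2·weight(w) forms μ_k, η_k with w_k = 1. On the other hand B(x_ab, y_cd) = [b = c] z_ad, and B
-- vanishes on pairs of x's and on pairs of y's. So r independent rows z_{ρ 1}, …, z_{ρ r} of z give
-- nr independent rows B(x_{ρ l, a}, ·), supported on the y's, and, through a dual family of these
-- rows of z, nr independent combinations of the rows B(y_cd, ·), supported on the x's. The Steinitz
-- exchange lemma then gives 2nr ≤ 2·weight(w).
module Submission where

open import Defs
open import Data.Bool using (Bool; true; false; _∧_; _xor_; if_then_else_)
open import Data.Bool.Properties
  using (∧-comm; ∧-assoc; ∧-zeroʳ; ∧-identityʳ; ∧-distribˡ-xor; ∧-distribʳ-xor;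
         xor-assoc; xor-comm; xor-same; xor-identityʳ; ¬-not; not-¬)
  renaming (_≟_ to _≟B_)
open import Data.Bool.Solver using (module xor-∧-Solver)
open import Data.Empty using (⊥-elim)
open import Data.Fin using (Fin; zero; suc; punchIn; _↑ˡ_; _↑ʳ_; splitAt; combine; remQuot)
open import Data.Fin.Properties
  using (suc-injective; ¬∀⟶∃¬; join-splitAt; combine-remQuot; remQuot-combine)
  renaming (_≟_ to _≟F_)
open import Data.Nat using (ℕ; zero; suc; _+_; _*_; _≤_; z≤n; s≤s)
open import Data.Nat.Properties using (+-identityʳ; *-cancelˡ-≤)
open import Data.Product using (_×_; _,_; ∃; proj₁; proj₂; uncurry; swap)
open import Data.Sum using (_⊎_; inj₁; inj₂)
open import Data.Vec.Functional using (_∷_; _++_)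
open import Data.Vec.Functional.Properties using (lookup-++ˡ; lookup-++ʳ)
open import Function using (_∘_)
open import Relation.Nullary using (¬_)
open import Relation.Nullary.Decidable using (⌊⌋-map′)
open import Relation.Binary.PropositionalEquality
open ≡-Reasoning

private
  variable
    A X Y Z : Set
    k m n p r s t : ℕ

xor-interchange : ∀ a b c d → (a xor b) xor (c xor d) ≡ (a xor c) xor (b xor d)
xor-interchange = solve 4 (λ a b c d → (a :+ b) :+ (c :+ d) := (a :+ c) :+ (b :+ d)) refl
  where open xor-∧-Solver

xor-cancelʳ : ∀ a b → (a xor b) xor b ≡ a
xor-cancelʳ = solve 2 (λ a b → (a :+ b) :+ b := a) refl
  where open xor-∧-Solver

∧-left-comm : ∀ a b c → a ∧ (b ∧ c) ≡ b ∧ (a ∧ c)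
∧-left-comm = solve 3 (λ a b c → a :* (b :* c) := b :* (a :* c)) refl
  where open xor-∧-Solver

m+m≤n+n⇒m≤n : m + m ≤ n + n → m ≤ n
m+m≤n+n⇒m≤n {m} {n} le = *-cancelˡ-≤ 2 (subst₂ _≤_ (double m) (double n) le)
  where
  double : ∀ k → k + k ≡ 2 * k
  double k = cong (k +_) (sym (+-identityʳ k))

∀-++ : {P : A → Set} (f : Fin s → A) (g : Fin t → A) →
       (∀ i → P (f i)) → (∀ j → P (g j)) → ∀ i → P ((f ++ g) i)
∀-++ {s = s} f g Pf Pg i with splitAt s i
... | inj₁ i' = Pf i'
... | inj₂ j  = Pg j

flatten : (Fin m → Fin k → A) → Fin (m * k) → A
flatten {k = k} H i = uncurry H (remQuot k i)

∀-flatten : {P : A → Set} (H : Fin m → Fin k → A) →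
            (∀ a l → P (H a l)) → ∀ i → P (flatten H i)
∀-flatten {m = m} {k = k} H PH i = PH (proj₁ (remQuot {m} k i)) (proj₂ (remQuot {m} k i))

flatten-combine : (H : Fin m → Fin k → A) (a : Fin m) (l : Fin k) →
                  flatten H (combine a l) ≡ H a l
flatten-combine H a l = cong (uncurry H) (remQuot-combine a l)

eqFin-suc : (a b : Fin n) → eqFin (suc a) (suc b) ≡ eqFin a b
eqFin-suc a b = ⌊⌋-map′ (cong suc) suc-injective (a ≟F b)

eqFin-refl : (a : Fin n) → eqFin a a ≡ true
eqFin-refl zero    = refl
eqFin-refl (suc a) = trans (eqFin-suc a a) (eqFin-refl a)

eqFin-sym : (a b : Fin n) → eqFin a b ≡ eqFin b a
eqFin-sym zero    zero    = refl
eqFin-sym zero    (suc b) = refl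
eqFin-sym (suc a) zero    = refl
eqFin-sym (suc a) (suc b) = trans (eqFin-suc a b) (trans (eqFin-sym a b) (sym (eqFin-suc b a)))

eqFin-sound : (a b : Fin n) → eqFin a b ≡ true → a ≡ b
eqFin-sound zero    zero    _ = refl
eqFin-sound (suc a) (suc b) e = cong suc (eqFin-sound a b (trans (sym (eqFin-suc a b)) e))

∧-true : ∀ {a b} → a ∧ b ≡ true → a ≡ true × b ≡ true
∧-true {true} {true} _ = refl , refl

eqVar-sound : (u v : Var n) → eqVar u v ≡ true → u ≡ v
eqVar-sound (inj₁ (a , b)) (inj₁ (c , d)) e =
  let a≡c , b≡d = ∧-true e
  in cong₂ (λ a b → inj₁ (a , b)) (eqFin-sound a c a≡c) (eqFin-sound b d b≡d)
eqVar-sound (inj₂ (a , b)) (inj₂ (c , d)) e =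
  let a≡c , b≡d = ∧-true e
  in cong₂ (λ a b → inj₂ (a , b)) (eqFin-sound a c a≡c) (eqFin-sound b d b≡d)

-- Sums over GF(2)

Σ₂-cong : {f g : Fin k → Bool} → (∀ i → f i ≡ g i) → Σ₂ f ≡ Σ₂ g
Σ₂-cong {zero}  f≗g = refl
Σ₂-cong {suc k} f≗g = cong₂ _xor_ (f≗g zero) (Σ₂-cong (f≗g ∘ suc))

Σ₂-zero : {f : Fin k → Bool} → (∀ i → f i ≡ false) → Σ₂ f ≡ false
Σ₂-zero {zero}  f≗0 = refl
Σ₂-zero {suc k} f≗0 = cong₂ _xor_ (f≗0 zero) (Σ₂-zero (f≗0 ∘ suc))

Σ₂-xor : (f g : Fin k → Bool) → Σ₂ (λ i → f i xor g i) ≡ Σ₂ f xor Σ₂ g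
Σ₂-xor {zero}  f g = refl
Σ₂-xor {suc k} f g =
  trans (cong ((f zero xor g zero) xor_) (Σ₂-xor (f ∘ suc) (g ∘ suc)))
        (xor-interchange (f zero) (g zero) _ _)

Σ₂-∧ˡ : ∀ a (f : Fin k → Bool) → Σ₂ (λ i → a ∧ f i) ≡ a ∧ Σ₂ f
Σ₂-∧ˡ {zero}  a f = sym (∧-zeroʳ a)
Σ₂-∧ˡ {suc k} a f =
  trans (cong ((a ∧ f zero) xor_) (Σ₂-∧ˡ a (f ∘ suc))) (sym (∧-distribˡ-xor a _ _))

Σ₂-∧ʳ : ∀ a (f : Fin k → Bool) → Σ₂ (λ i → f i ∧ a) ≡ Σ₂ f ∧ a
Σ₂-∧ʳ a f = trans (Σ₂-cong (λ i → ∧-comm (f i) a)) (trans (Σ₂-∧ˡ a f) (∧-comm a _))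

Σ₂-swap : (h : Fin k → Fin m → Bool) →
          Σ₂ (λ i → Σ₂ (h i)) ≡ Σ₂ (λ j → Σ₂ (λ i → h i j))
Σ₂-swap {zero} {m} h = sym (Σ₂-zero {m} (λ _ → refl))
Σ₂-swap {suc k} h =
  trans (cong (Σ₂ (h zero) xor_) (Σ₂-swap (h ∘ suc))) (sym (Σ₂-xor (h zero) _))

Σ₂-punchIn : (j : Fin (suc k)) (h : Fin (suc k) → Bool) → Σ₂ h ≡ h j xor Σ₂ (h ∘ punchIn j)
Σ₂-punchIn zero h = refl
Σ₂-punchIn {suc k} (suc j) h =
  trans (cong (h zero xor_) (Σ₂-punchIn j (h ∘ suc))) (xor-left-comm (h zero) (h (suc j)) _)
  where
  xor-left-comm : ∀ a b c → a xor (b xor c) ≡ b xor (a xor c)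
  xor-left-comm = solve 3 (λ a b c → a :+ (b :+ c) := b :+ (a :+ c)) refl
    where open xor-∧-Solver

Σ₂-++ : (h : Fin (s + t) → Bool) →
        Σ₂ h ≡ Σ₂ (λ i → h (i ↑ˡ t)) xor Σ₂ (λ j → h (s ↑ʳ j))
Σ₂-++ {zero}  h = refl
Σ₂-++ {suc s} h = trans (cong (h zero xor_) (Σ₂-++ {s} (h ∘ suc))) (sym (xor-assoc (h zero) _ _))

Σ₂-combine : (h : Fin (m * k) → Bool) →
             Σ₂ h ≡ Σ₂ (λ (a : Fin m) → Σ₂ (λ (l : Fin k) → h (combine a l)))
Σ₂-combine {zero}      h = refl
Σ₂-combine {suc m} {k} h =
  trans (Σ₂-++ {k} h)
        (cong (Σ₂ (λ l → h (l ↑ˡ (m * k))) xor_) (Σ₂-combine {m} (h ∘ (k ↑ʳ_))))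

Σ₂-δ : (a : Fin k) (h : Fin k → Bool) → Σ₂ (λ i → eqFin i a ∧ h i) ≡ h a
Σ₂-δ {suc k} zero    h =
  trans (cong (h zero xor_) (Σ₂-zero {k} (λ _ → refl))) (xor-identityʳ (h zero))
Σ₂-δ {suc k} (suc a) h =
  trans (Σ₂-cong (λ i → cong (_∧ h (suc i)) (eqFin-suc i a))) (Σ₂-δ a (h ∘ suc))

support : (w : Fin m → Bool) → Fin (weight w) → Fin m
support {suc m} w with w zero
... | true  = zero ∷ (suc ∘ support (w ∘ suc))
... | false = suc ∘ support (w ∘ suc)

Σ₂-support : (w h : Fin m → Bool) → Σ₂ (λ k → w k ∧ h k) ≡ Σ₂ (h ∘ support w)
Σ₂-support {zero}  w h = refl
Σ₂-support {suc m} w h with w zero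
... | true  = cong (h zero xor_) (Σ₂-support (w ∘ suc) (h ∘ suc))
... | false = Σ₂-support (w ∘ suc) (h ∘ suc)

-- Linear algebra over GF(2)

lincomb : (Fin k → Bool) → (Fin k → X → Bool) → X → Bool
lincomb c v x = Σ₂ (λ i → c i ∧ v i x)

-- Defs.LinIndep is the case X = Fin n.
Independent : (Fin k → X → Bool) → Set
Independent v = ∀ c → (∀ x → lincomb c v x ≡ false) → ∀ i → c i ≡ false

_∈Span_ : (X → Bool) → (Fin k → X → Bool) → Set
u ∈Span v = ∃ λ c → ∀ x → u x ≡ lincomb c v x

lincomb-xor : (c d : Fin k → Bool) (v : Fin k → X → Bool) (x : X) →
              lincomb (λ i → c i xor d i) v x ≡ lincomb c v x xor lincomb d v x
lincomb-xor c d v x =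
  trans (Σ₂-cong (λ i → ∧-distribʳ-xor (v i x) (c i) (d i)))
        (Σ₂-xor (λ i → c i ∧ v i x) (λ i → d i ∧ v i x))

lincomb-∧ : ∀ a (c : Fin k → Bool) (v : Fin k → X → Bool) (x : X) →
            lincomb (λ i → a ∧ c i) v x ≡ a ∧ lincomb c v x
lincomb-∧ a c v x =
  trans (Σ₂-cong (λ i → ∧-assoc a (c i) (v i x))) (Σ₂-∧ˡ a (λ i → c i ∧ v i x))

lincomb-δ : (j : Fin k) (b : Bool) (v : Fin k → X → Bool) (x : X) →
            lincomb (λ i → eqFin i j ∧ b) v x ≡ b ∧ v j x
lincomb-δ j b v x =
  trans (Σ₂-cong (λ i → ∧-assoc (eqFin i j) b (v i x))) (Σ₂-δ j (λ i → b ∧ v i x))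

lincomb-punchIn : (j : Fin (suc k)) (c : Fin (suc k) → Bool) (v : Fin (suc k) → X → Bool) (x : X) →
                  lincomb c v x ≡ (c j ∧ v j x) xor lincomb (c ∘ punchIn j) (v ∘ punchIn j) x
lincomb-punchIn j c v x = Σ₂-punchIn j (λ i → c i ∧ v i x)

lincomb-++ : (c : Fin (s + t) → Bool) (f : Fin s → X → Bool) (g : Fin t → X → Bool) (x : X) →
             lincomb c (f ++ g) x ≡
             lincomb (λ i → c (i ↑ˡ t)) f x xor lincomb (λ j → c (s ↑ʳ j)) g x
lincomb-++ {s} {t} c f g x =
  trans (Σ₂-++ {s} _)
        (cong₂ _xor_ (Σ₂-cong (λ i → cong (λ u → c (i ↑ˡ t) ∧ u x) (lookup-++ˡ f g i)))
                     (Σ₂-cong (λ j → cong (λ u → c (s ↑ʳ j) ∧ u x) (lookup-++ʳ f g j))))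

lincomb-∈Span : {f : Fin s → X → Bool} {g : Fin p → X → Bool} →
                (∀ i → f i ∈Span g) → ∀ c → lincomb c f ∈Span g
lincomb-∈Span {f = f} {g} f∈g c = (λ j → lincomb c C j) , λ x → begin
  Σ₂ (λ i → c i ∧ f i x)
    ≡⟨ Σ₂-cong (λ i → cong (c i ∧_) (proj₂ (f∈g i) x)) ⟩
  Σ₂ (λ i → c i ∧ Σ₂ (λ j → C i j ∧ g j x))
    ≡⟨ Σ₂-cong (λ i → sym (Σ₂-∧ˡ (c i) (λ j → C i j ∧ g j x))) ⟩
  Σ₂ (λ i → Σ₂ (λ j → c i ∧ (C i j ∧ g j x)))
    ≡⟨ Σ₂-swap (λ i j → c i ∧ (C i j ∧ g j x)) ⟩
  Σ₂ (λ j → Σ₂ (λ i → c i ∧ (C i j ∧ g j x)))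
    ≡⟨ Σ₂-cong (λ j → Σ₂-cong (λ i → sym (∧-assoc (c i) (C i j) (g j x)))) ⟩
  Σ₂ (λ j → Σ₂ (λ i → (c i ∧ C i j) ∧ g j x))
    ≡⟨ Σ₂-cong (λ j → Σ₂-∧ʳ (g j x) (λ i → c i ∧ C i j)) ⟩
  Σ₂ (λ j → lincomb c C j ∧ g j x) ∎
  where
  C = λ i → proj₁ (f∈g i)

independent-restrict : (h : Y → X) (v : Fin k → X → Bool) →
                       Independent (λ i → v i ∘ h) → Independent v
independent-restrict h v ind c vanish = ind c (vanish ∘ h)

independent-identity : Independent {k} (eqFin {k})
independent-identity c vanish i =
  trans (sym (Σ₂-δ i c)) (trans (Σ₂-cong (λ j → ∧-comm (eqFin j i) (c j))) (vanish i))

independent⇒nonzero : {v : Fin k → X → Bool} → Independent v →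
                      ∀ i → ¬ (∀ x → v i x ≡ false)
independent⇒nonzero {v = v} ind i vᵢ≡0 =
  not-¬ (eqFin-refl i) (ind (λ j → eqFin j i) indicator-vanishes i)
  where
  indicator-vanishes : ∀ x → lincomb (λ j → eqFin j i) v x ≡ false
  indicator-vanishes x = trans (Σ₂-δ i (λ j → v j x)) (vᵢ≡0 x)

nonzero-entry : (u : Fin n → Bool) → ¬ (∀ d → u d ≡ false) → ∃ λ d → u d ≡ true
nonzero-entry u u≢0 =
  let d , u[d]≢false = ¬∀⟶∃¬ _ (λ d → u d ≡ false) (λ d → u d ≟B false) u≢0
  in d , ¬-not u[d]≢false

shear : (a : Fin k → Bool) → (Fin (suc k) → X → Bool) → Fin k → X → Bool
shear a v i x = v (suc i) x xor (a i ∧ v zero x)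

independent-shear : {v : Fin (suc k) → X → Bool} → Independent v → ∀ a → Independent (shear a v)
independent-shear {v = v} ind a c vanish i = ind (c₀ ∷ c) (λ x → trans (unshear x) (vanish x)) (suc i)
  where
  c₀ = Σ₂ (λ i → c i ∧ a i)
  unshear : ∀ x → lincomb (c₀ ∷ c) v x ≡ lincomb c (shear a v) x
  unshear x = sym (begin
    Σ₂ (λ i → c i ∧ (v (suc i) x xor (a i ∧ v zero x)))
      ≡⟨ Σ₂-cong (λ i → distrib (c i) (v (suc i) x) (a i) (v zero x)) ⟩
    Σ₂ (λ i → (c i ∧ v (suc i) x) xor ((c i ∧ a i) ∧ v zero x))
      ≡⟨ Σ₂-xor (λ i → c i ∧ v (suc i) x) (λ i → (c i ∧ a i) ∧ v zero x) ⟩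
    Σ₂ (λ i → c i ∧ v (suc i) x) xor Σ₂ (λ i → (c i ∧ a i) ∧ v zero x)
      ≡⟨ cong (Σ₂ (λ i → c i ∧ v (suc i) x) xor_) (Σ₂-∧ʳ (v zero x) (λ i → c i ∧ a i)) ⟩
    Σ₂ (λ i → c i ∧ v (suc i) x) xor (c₀ ∧ v zero x)
      ≡⟨ xor-comm (Σ₂ (λ i → c i ∧ v (suc i) x)) (c₀ ∧ v zero x) ⟩
    (c₀ ∧ v zero x) xor Σ₂ (λ i → c i ∧ v (suc i) x) ∎)
    where
    distrib : ∀ c y a z → c ∧ (y xor (a ∧ z)) ≡ (c ∧ y) xor ((c ∧ a) ∧ z)
    distrib = solve 4 (λ c y a z → c :* (y :+ (a :* z)) := (c :* y) :+ ((c :* a) :* z)) refl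
      where open xor-∧-Solver

columns : (Fin r → Fin n → Bool) → Fin n → Fin r → Bool
columns R d l = R l d

lincomb-columns-shear : (a : Fin r → Bool) (R : Fin (suc r) → Fin n → Bool)
                        (v : Fin n → Bool) (l : Fin r) →
                        lincomb v (columns (shear a R)) l ≡
                        lincomb v (columns R) (suc l) xor (a l ∧ lincomb v (columns R) zero)
lincomb-columns-shear a R v l = begin
  Σ₂ (λ d → v d ∧ (R (suc l) d xor (a l ∧ R zero d)))
    ≡⟨ Σ₂-cong (λ d → distrib (v d) (R (suc l) d) (a l) (R zero d)) ⟩
  Σ₂ (λ d → (v d ∧ R (suc l) d) xor (a l ∧ (v d ∧ R zero d)))
    ≡⟨ Σ₂-xor (λ d → v d ∧ R (suc l) d) (λ d → a l ∧ (v d ∧ R zero d)) ⟩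
  lincomb v (columns R) (suc l) xor Σ₂ (λ d → a l ∧ (v d ∧ R zero d))
    ≡⟨ cong (lincomb v (columns R) (suc l) xor_) (Σ₂-∧ˡ (a l) (λ d → v d ∧ R zero d)) ⟩
  lincomb v (columns R) (suc l) xor (a l ∧ lincomb v (columns R) zero) ∎
  where
  distrib : ∀ v r a r₀ → v ∧ (r xor (a ∧ r₀)) ≡ (v ∧ r) xor (a ∧ (v ∧ r₀))
  distrib = solve 4 (λ v r a r₀ → v :* (r :+ (a :* r₀)) := (v :* r) :+ (a :* (v :* r₀))) refl
    where open xor-∧-Solver

columns-span-unshear : (R : Fin (suc r) → Fin n → Bool) (d₀ : Fin n) → R zero d₀ ≡ true →
                       (∀ t' → t' ∈Span columns (shear (λ l → R (suc l) d₀) R)) →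
                       ∀ t → t ∈Span columns R
columns-span-unshear {r} {n} R d₀ R₀d₀≡1 sheared-span t = v , solves
  where
  a : Fin r → Bool
  a l = R (suc l) d₀
  solution' = sheared-span (λ l → t (suc l) xor (a l ∧ t zero))
  v' = proj₁ solution'
  S₀ = lincomb v' (columns R) zero
  β = t zero xor S₀
  v : Fin n → Bool
  v d = v' d xor (eqFin d d₀ ∧ β)
  update : ∀ l → lincomb v (columns R) l ≡ lincomb v' (columns R) l xor (β ∧ R l d₀)
  update l = trans (lincomb-xor v' _ (columns R) l)
                   (cong (lincomb v' (columns R) l xor_) (lincomb-δ d₀ β (columns R) l))
  solves : ∀ l → t l ≡ lincomb v (columns R) l
  solves zero    = begin
    t zero                          ≡⟨ xor-cancelʳ (t zero) S₀ ⟨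
    β xor S₀                        ≡⟨ xor-comm β S₀ ⟩
    S₀ xor β                        ≡⟨ cong (S₀ xor_) (∧-identityʳ β) ⟨
    S₀ xor (β ∧ true)               ≡⟨ cong (λ b → S₀ xor (β ∧ b)) R₀d₀≡1 ⟨
    S₀ xor (β ∧ R zero d₀)          ≡⟨ update zero ⟨
    lincomb v (columns R) zero      ∎
  solves (suc l) = begin
    t (suc l)
      ≡⟨ cancel (t (suc l)) (a l) (t zero) S₀ ⟨
    ((t (suc l) xor (a l ∧ t zero)) xor (a l ∧ S₀)) xor (β ∧ a l)
      ≡⟨ cong (λ u → (u xor (a l ∧ S₀)) xor (β ∧ a l)) (proj₂ solution' l) ⟩
    (lincomb v' (columns (shear a R)) l xor (a l ∧ S₀)) xor (β ∧ a l)
      ≡⟨ cong (λ u → (u xor (a l ∧ S₀)) xor (β ∧ a l)) (lincomb-columns-shear a R v' l) ⟩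
    ((lincomb v' (columns R) (suc l) xor (a l ∧ S₀)) xor (a l ∧ S₀)) xor (β ∧ a l)
      ≡⟨ cong (_xor (β ∧ a l)) (xor-cancelʳ (lincomb v' (columns R) (suc l)) (a l ∧ S₀)) ⟩
    lincomb v' (columns R) (suc l) xor (β ∧ a l)
      ≡⟨ update (suc l) ⟨
    lincomb v (columns R) (suc l) ∎
    where
    cancel : ∀ t a t₀ s₀ → ((t xor (a ∧ t₀)) xor (a ∧ s₀)) xor ((t₀ xor s₀) ∧ a) ≡ t
    cancel = solve 4 (λ t a t₀ s₀ → ((t :+ (a :* t₀)) :+ (a :* s₀)) :+ ((t₀ :+ s₀) :* a) := t)
                     refl
      where open xor-∧-Solver

independent-rows⇒columns-span : (R : Fin r → Fin n → Bool) → Independent R →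
                                 ∀ t → t ∈Span columns R
independent-rows⇒columns-span {zero}  R ind t = (λ _ → false) , λ ()
independent-rows⇒columns-span {suc r} R ind =
  columns-span-unshear R d₀ R₀d₀≡1
    (independent-rows⇒columns-span _ (independent-shear {v = R} ind (λ l → R (suc l) d₀)))
  where
  pivot = nonzero-entry (R zero) (independent⇒nonzero {v = R} ind zero)
  d₀ = proj₁ pivot
  R₀d₀≡1 = proj₂ pivot

shear-∈Span : {f : Fin (suc s) → X → Bool} {g : Fin (suc p) → X → Bool}
              (f∈g : ∀ i → f i ∈Span g) →
              ∀ j → proj₁ (f∈g zero) j ≡ true →
              ∀ i → shear (λ i → proj₁ (f∈g (suc i)) j) f i ∈Span (g ∘ punchIn j)
shear-∈Span {p = p} {f = f} {g} f∈g j C₀j≡1 i = D ∘ punchIn j , λ x → begin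
  f (suc i) x xor (a ∧ f zero x)
    ≡⟨ cong₂ (λ u u₀ → u xor (a ∧ u₀)) (proj₂ (f∈g (suc i)) x) (proj₂ (f∈g zero) x) ⟩
  lincomb (C (suc i)) g x xor (a ∧ lincomb (C zero) g x)
    ≡⟨ cong (lincomb (C (suc i)) g x xor_) (lincomb-∧ a (C zero) g x) ⟨
  lincomb (C (suc i)) g x xor lincomb (λ k → a ∧ C zero k) g x
    ≡⟨ lincomb-xor (C (suc i)) (λ k → a ∧ C zero k) g x ⟨
  lincomb D g x
    ≡⟨ lincomb-punchIn j D g x ⟩
  (D j ∧ g j x) xor lincomb (D ∘ punchIn j) (g ∘ punchIn j) x
    ≡⟨ cong (λ b → (b ∧ g j x) xor lincomb (D ∘ punchIn j) (g ∘ punchIn j) x) D[j]≡0 ⟩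
  lincomb (D ∘ punchIn j) (g ∘ punchIn j) x ∎
  where
  C = λ i → proj₁ (f∈g i)
  a = C (suc i) j
  D : Fin (suc p) → Bool
  D k = C (suc i) k xor (a ∧ C zero k)
  D[j]≡0 : D j ≡ false
  D[j]≡0 = begin
    a xor (a ∧ C zero j) ≡⟨ cong (λ b → a xor (a ∧ b)) C₀j≡1 ⟩
    a xor (a ∧ true)     ≡⟨ cong (a xor_) (∧-identityʳ a) ⟩
    a xor a              ≡⟨ xor-same a ⟩
    false                ∎

independent-∈Span⇒≤ : (f : Fin s → X → Bool) (g : Fin p → X → Bool) →
                      Independent f → (∀ i → f i ∈Span g) → s ≤ p
independent-∈Span⇒≤ {s = zero}              f g ind f∈g = z≤n
independent-∈Span⇒≤ {s = suc s} {p = zero}  f g ind f∈g =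
  ⊥-elim (independent⇒nonzero {v = f} ind zero (proj₂ (f∈g zero)))
independent-∈Span⇒≤ {s = suc s} {p = suc p} f g ind f∈g =
  s≤s (independent-∈Span⇒≤ (shear a f) (g ∘ punchIn j) (independent-shear {v = f} ind a)
                            (shear-∈Span {f = f} {g} f∈g j C₀j≡1))
  where
  C₀≡0⇒f₀≡0 : (∀ j → proj₁ (f∈g zero) j ≡ false) → ∀ x → f zero x ≡ false
  C₀≡0⇒f₀≡0 C₀≡0 x =
    trans (proj₂ (f∈g zero) x) (Σ₂-zero (λ j → cong (_∧ g j x) (C₀≡0 j)))
  pivot =
    nonzero-entry (proj₁ (f∈g zero)) (independent⇒nonzero {v = f} ind zero ∘ C₀≡0⇒f₀≡0)
  j = proj₁ pivot
  C₀j≡1 = proj₂ pivot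
  a : Fin s → Bool
  a i = proj₁ (f∈g (suc i)) j

independent-⊗ : (R : Fin r → X → Bool) → Independent R →
                (F : Fin (n * r) → Fin n × X → Bool) →
                (∀ a l c x → F (combine a l) (c , x) ≡ eqFin a c ∧ R l x) → Independent F
independent-⊗ {r = r} {n = n} R ind F F≡δ⊗R κ vanish i =
  subst (λ i → κ i ≡ false) (combine-remQuot {n} r i) (ind (κ' a) (slice a) l)
  where
  a = proj₁ (remQuot {n} r i)
  l = proj₂ (remQuot {n} r i)
  κ' : Fin n → Fin r → Bool
  κ' a l = κ (combine a l)
  slice : ∀ c x → lincomb (κ' c) R x ≡ false
  slice c x = begin
    lincomb (κ' c) R x
      ≡⟨ Σ₂-δ c (λ a → lincomb (κ' a) R x) ⟨
    Σ₂ (λ a → eqFin a c ∧ lincomb (κ' a) R x)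
      ≡⟨ Σ₂-cong (λ a → sym (Σ₂-∧ˡ (eqFin a c) (λ l → κ' a l ∧ R l x))) ⟩
    Σ₂ (λ a → Σ₂ (λ l → eqFin a c ∧ (κ' a l ∧ R l x)))
      ≡⟨ Σ₂-cong (λ a → Σ₂-cong (λ l → trans (∧-left-comm (eqFin a c) (κ' a l) (R l x))
                                              (cong (κ' a l ∧_) (sym (F≡δ⊗R a l c x))))) ⟩
    Σ₂ (λ a → Σ₂ (λ l → κ' a l ∧ F (combine a l) (c , x)))
      ≡⟨ Σ₂-combine {n} (λ i → κ i ∧ F i (c , x)) ⟨
    lincomb κ F (c , x)
      ≡⟨ vanish (c , x) ⟩
    false ∎

independent-++ : (f : Fin s → Y ⊎ Z → Bool) (g : Fin t → Y ⊎ Z → Bool) →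
                 Independent (λ i z → f i (inj₂ z)) → (∀ j z → g j (inj₂ z) ≡ false) →
                 Independent (λ j y → g j (inj₁ y)) → Independent (f ++ g)
independent-++ {s = s} {t = t} f g f-ind g≡0 g-ind c vanish = c≡0
  where
  cˡ : Fin s → Bool
  cˡ i = c (i ↑ˡ t)
  cʳ : Fin t → Bool
  cʳ j = c (s ↑ʳ j)
  cˡ≡0 : ∀ i → cˡ i ≡ false
  cˡ≡0 = f-ind cˡ λ z → begin
    lincomb cˡ f (inj₂ z)
      ≡⟨ xor-identityʳ _ ⟨
    lincomb cˡ f (inj₂ z) xor false
      ≡⟨ cong (lincomb cˡ f (inj₂ z) xor_)
              (Σ₂-zero (λ j → trans (cong (cʳ j ∧_) (g≡0 j z)) (∧-zeroʳ (cʳ j)))) ⟨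
    lincomb cˡ f (inj₂ z) xor lincomb cʳ g (inj₂ z)
      ≡⟨ lincomb-++ c f g (inj₂ z) ⟨
    lincomb c (f ++ g) (inj₂ z)
      ≡⟨ vanish (inj₂ z) ⟩
    false ∎
  cʳ≡0 : ∀ j → cʳ j ≡ false
  cʳ≡0 = g-ind cʳ λ y → begin
    lincomb cʳ g (inj₁ y)
      ≡⟨ cong (_xor lincomb cʳ g (inj₁ y))
              (Σ₂-zero (λ i → cong (_∧ f i (inj₁ y)) (cˡ≡0 i))) ⟨
    lincomb cˡ f (inj₁ y) xor lincomb cʳ g (inj₁ y)
      ≡⟨ lincomb-++ c f g (inj₁ y) ⟨
    lincomb c (f ++ g) (inj₁ y)
      ≡⟨ vanish (inj₁ y) ⟩
    false ∎
  c≡0 : ∀ i → c i ≡ false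
  c≡0 i with splitAt s i | join-splitAt s t i
  ... | inj₁ i' | refl = cˡ≡0 i'
  ... | inj₂ j  | refl = cʳ≡0 j

-- Γ and the polar form

Γ-xor : (α : Fin m → Mat n) (z w : Mat n) (k : Fin m) → Γ α (z ⊕M w) k ≡ Γ α z k xor Γ α w k
Γ-xor α z w k =
  trans (Σ₂-cong (λ i → trans (Σ₂-cong (λ j → ∧-distribˡ-xor (α k i j) (z i j) (w i j)))
                              (Σ₂-xor (λ j → α k i j ∧ z i j) (λ j → α k i j ∧ w i j))))
        (Σ₂-xor (λ i → Σ₂ (λ j → α k i j ∧ z i j)) (λ i → Σ₂ (λ j → α k i j ∧ w i j)))

Γ-∧ : (α : Fin m → Mat n) (b : Bool) (z : Mat n) (k : Fin m) → Γ α (b ·M z) k ≡ b ∧ Γ α z k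
Γ-∧ α b z k =
  trans (Σ₂-cong (λ i → trans (Σ₂-cong (λ j → ∧-left-comm (α k i j) b (z i j)))
                              (Σ₂-∧ˡ b (λ j → α k i j ∧ z i j))))
        (Σ₂-∧ˡ b (λ i → Σ₂ (λ j → α k i j ∧ z i j)))

Γ-transpose : (α : Fin m → Mat n) (z : Mat n) (h : Fin m → Bool) →
              Σ₂ (λ k → Γ α z k ∧ h k) ≡
              Σ₂ (λ i → Σ₂ (λ j → z i j ∧ Σ₂ (λ k → α k i j ∧ h k)))
Γ-transpose α z h = begin
  Σ₂ (λ k → Σ₂ (λ i → Σ₂ (λ j → α k i j ∧ z i j)) ∧ h k)
    ≡⟨ Σ₂-cong (λ k → sym (trans (Σ₂-cong (λ i → Σ₂-∧ʳ (h k) (λ j → α k i j ∧ z i j)))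
                                 (Σ₂-∧ʳ (h k) (λ i → Σ₂ (λ j → α k i j ∧ z i j))))) ⟩
  Σ₂ (λ k → Σ₂ (λ i → Σ₂ (λ j → (α k i j ∧ z i j) ∧ h k)))
    ≡⟨ Σ₂-swap (λ k i → Σ₂ (λ j → (α k i j ∧ z i j) ∧ h k)) ⟩
  Σ₂ (λ i → Σ₂ (λ k → Σ₂ (λ j → (α k i j ∧ z i j) ∧ h k)))
    ≡⟨ Σ₂-cong (λ i → Σ₂-swap (λ k j → (α k i j ∧ z i j) ∧ h k)) ⟩
  Σ₂ (λ i → Σ₂ (λ j → Σ₂ (λ k → (α k i j ∧ z i j) ∧ h k)))
    ≡⟨ Σ₂-cong (λ i → Σ₂-cong (λ j → trans (Σ₂-cong (λ k → shuffle (α k i j) (z i j) (h k)))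
                                           (Σ₂-∧ˡ (z i j) (λ k → α k i j ∧ h k)))) ⟩
  Σ₂ (λ i → Σ₂ (λ j → z i j ∧ Σ₂ (λ k → α k i j ∧ h k))) ∎
  where
  shuffle : ∀ a b c → (a ∧ b) ∧ c ≡ b ∧ (a ∧ c)
  shuffle = solve 3 (λ a b c → (a :* b) :* c := b :* (a :* c)) refl
    where open xor-∧-Solver

coeffMatMul-sum-xy : (z : Mat n) (a b c d : Fin n) →
  Σ₂ (λ i → Σ₂ (λ j → z i j ∧ coeffMatMul i j (inj₁ (a , b)) (inj₂ (c , d)))) ≡
  eqFin b c ∧ z a d
coeffMatMul-sum-xy z a b c d = begin
  Σ₂ (λ i → Σ₂ (λ j → z i j ∧ (eqFin a i ∧ eqFin b c ∧ eqFin d j)))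
    ≡⟨ Σ₂-cong (λ i → Σ₂-cong (λ j → shuffle (z i j) (eqFin a i) (eqFin b c) (eqFin d j))) ⟩
  Σ₂ (λ i → Σ₂ (λ j → eqFin a i ∧ (eqFin d j ∧ (eqFin b c ∧ z i j))))
    ≡⟨ Σ₂-cong (λ i → Σ₂-∧ˡ (eqFin a i) (λ j → eqFin d j ∧ (eqFin b c ∧ z i j))) ⟩
  Σ₂ (λ i → eqFin a i ∧ Σ₂ (λ j → eqFin d j ∧ (eqFin b c ∧ z i j)))
    ≡⟨ Σ₂-cong (λ i → cong₂ _∧_ (eqFin-sym a i)
                               (Σ₂-cong (λ j → cong (_∧ (eqFin b c ∧ z i j)) (eqFin-sym d j)))) ⟩
  Σ₂ (λ i → eqFin i a ∧ Σ₂ (λ j → eqFin j d ∧ (eqFin b c ∧ z i j)))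
    ≡⟨ Σ₂-δ a (λ i → Σ₂ (λ j → eqFin j d ∧ (eqFin b c ∧ z i j))) ⟩
  Σ₂ (λ j → eqFin j d ∧ (eqFin b c ∧ z a j))
    ≡⟨ Σ₂-δ d (λ j → eqFin b c ∧ z a j) ⟩
  eqFin b c ∧ z a d ∎
  where
  shuffle : ∀ z a e d → z ∧ (a ∧ e ∧ d) ≡ a ∧ (d ∧ (e ∧ z))
  shuffle = solve 4 (λ z a e d → z :* (a :* (e :* d)) := a :* (d :* (e :* z))) refl
    where open xor-∧-Solver

-- On basis vectors, the polar form B(x, y) = Q(x + y) + Q(x) + Q(y) of Q = Σ_k w_k μ_k η_k:
-- off the diagonal B(u, v) is the coefficient of the monomial u v in Q, and B(u, u) = 0.
polar : (μ η : Fin m → LinForm n) → (Fin m → Bool) → Var n → Var n → Bool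
polar μ η w u v = Σ₂ (λ k → w k ∧ ((μ k u ∧ η k v) xor (η k u ∧ μ k v)))

polar-row-∈Span : (μ η : Fin m → LinForm n) (w : Fin m → Bool) (u : Var n) →
                  polar μ η w u ∈Span ((η ∘ support w) ++ (μ ∘ support w))
polar-row-∈Span μ η w u = cμ ++ cη , λ x → begin
  polar μ η w u x
    ≡⟨ Σ₂-support w (λ k → (μ k u ∧ η k x) xor (η k u ∧ μ k x)) ⟩
  Σ₂ (λ j → (cμ j ∧ η (σ j) x) xor (cη j ∧ μ (σ j) x))
    ≡⟨ Σ₂-xor (λ j → cμ j ∧ η (σ j) x) (λ j → cη j ∧ μ (σ j) x) ⟩
  lincomb cμ (η ∘ σ) x xor lincomb cη (μ ∘ σ) x
    ≡⟨ cong₂ _xor_ (Σ₂-cong (λ i → cong (_∧ η (σ i) x) (lookup-++ˡ cμ cη i)))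
                   (Σ₂-cong (λ j → cong (_∧ μ (σ j) x) (lookup-++ʳ cμ cη j))) ⟨
  lincomb (λ i → (cμ ++ cη) (i ↑ˡ _)) (η ∘ σ) x xor
  lincomb (λ j → (cμ ++ cη) (_ ↑ʳ j)) (μ ∘ σ) x
    ≡⟨ lincomb-++ (cμ ++ cη) (η ∘ σ) (μ ∘ σ) x ⟨
  lincomb (cμ ++ cη) ((η ∘ σ) ++ (μ ∘ σ)) x ∎
  where
  σ = support w
  cμ cη : Fin (weight w) → Bool
  cμ j = μ (σ j) u
  cη j = η (σ j) u

polar-diagonal : (μ η : Fin m → LinForm n) (w : Fin m → Bool) (u : Var n) →
                 polar μ η w u u ≡ false
polar-diagonal μ η w u = Σ₂-zero λ k → begin
  w k ∧ ((μ k u ∧ η k u) xor (η k u ∧ μ k u))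
    ≡⟨ cong (λ b → w k ∧ ((μ k u ∧ η k u) xor b)) (∧-comm (η k u) (μ k u)) ⟩
  w k ∧ ((μ k u ∧ η k u) xor (μ k u ∧ η k u))
    ≡⟨ cong (w k ∧_) (xor-same (μ k u ∧ η k u)) ⟩
  w k ∧ false
    ≡⟨ ∧-zeroʳ (w k) ⟩
  false ∎

coeffProd-off-diagonal : (μ η : LinForm n) (u v : Var n) → eqVar u v ≡ false →
                         coeffProd μ η u v ≡ (μ u ∧ η v) xor (η u ∧ μ v)
coeffProd-off-diagonal μ η u v u≢v =
  trans (cong (λ b → if b then μ u ∧ η u else ((μ u ∧ η v) xor (μ v ∧ η u))) u≢v)
        (cong ((μ u ∧ η v) xor_) (∧-comm (μ v) (η u)))

coeffMatMul-diagonal : (i j : Fin n) (u : Var n) → coeffMatMul i j u u ≡ false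
coeffMatMul-diagonal i j (inj₁ _) = refl
coeffMatMul-diagonal i j (inj₂ _) = refl

polar-Γ : (μ η : Fin m → LinForm n) (α : Fin m → Mat n) → ComputesMatMul μ η α →
          ∀ z u v →
          polar μ η (Γ α z) u v ≡ Σ₂ (λ i → Σ₂ (λ j → z i j ∧ coeffMatMul i j u v))
polar-Γ μ η α computes z u v with eqVar u v in e
... | false = begin
  polar μ η (Γ α z) u v
    ≡⟨ Σ₂-cong (λ k → cong (Γ α z k ∧_) (coeffProd-off-diagonal (μ k) (η k) u v e)) ⟨
  Σ₂ (λ k → Γ α z k ∧ coeffProd (μ k) (η k) u v)
    ≡⟨ Γ-transpose α z (λ k → coeffProd (μ k) (η k) u v) ⟩
  Σ₂ (λ i → Σ₂ (λ j → z i j ∧ Σ₂ (λ k → α k i j ∧ coeffProd (μ k) (η k) u v)))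
    ≡⟨ Σ₂-cong (λ i → Σ₂-cong (λ j → cong (z i j ∧_) (computes i j u v))) ⟩
  Σ₂ (λ i → Σ₂ (λ j → z i j ∧ coeffMatMul i j u v)) ∎
... | true with refl ← eqVar-sound u v e =
  trans (polar-diagonal μ η (Γ α z) u)
        (sym (Σ₂-zero λ i → Σ₂-zero λ j →
                trans (cong (z i j ∧_) (coeffMatMul-diagonal i j u)) (∧-zeroʳ (z i j))))

module RankBound {m n r : ℕ} (μ η : Fin m → LinForm n) (α : Fin m → Mat n)
                 (computes : ComputesMatMul μ η α) (z : Mat n)
                 (ρ : Fin r → Fin n) (ρ-independent : LinIndep (λ l → z (ρ l))) where

  w : Fin m → Bool
  w = Γ α z

  B : Var n → Var n → Bool
  B = polar μ η w

  B-xy : ∀ a b c d → B (inj₁ (a , b)) (inj₂ (c , d)) ≡ eqFin b c ∧ z a d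
  B-xy a b c d = trans (polar-Γ μ η α computes z _ _) (coeffMatMul-sum-xy z a b c d)

  B-yx : ∀ a b c d → B (inj₂ (c , d)) (inj₁ (a , b)) ≡ eqFin b c ∧ z a d
  B-yx a b c d = trans (polar-Γ μ η α computes z _ _) (coeffMatMul-sum-xy z a b c d)

  B-yy : ∀ p q → B (inj₂ p) (inj₂ q) ≡ false
  B-yy p q =
    trans (polar-Γ μ η α computes z _ _) (Σ₂-zero λ i → Σ₂-zero λ j → ∧-zeroʳ (z i j))

  dual : Fin r → Fin n → Bool
  dual l = proj₁ (independent-rows⇒columns-span (λ l → z (ρ l)) ρ-independent (eqFin l))

  dual-spec : ∀ l l' → eqFin l l' ≡ Σ₂ (λ d → dual l d ∧ z (ρ l') d)
  dual-spec l = proj₂ (independent-rows⇒columns-span (λ l → z (ρ l)) ρ-independent (eqFin l))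

  z·dual : Fin r → Fin n → Bool
  z·dual l a = Σ₂ (λ d → dual l d ∧ z a d)

  z·dual-independent : Independent z·dual
  z·dual-independent = independent-restrict ρ z·dual λ c vanish →
    independent-identity c λ l' →
      trans (Σ₂-cong (λ l → cong (c l ∧_) (dual-spec l l'))) (vanish l')

  xRow yCombination : Fin n → Fin r → Var n → Bool
  xRow a l = B (inj₁ (ρ l , a))
  yCombination c l = lincomb (dual l) (λ d → B (inj₂ (c , d)))

  xRows yCombinations : Fin (n * r) → Var n → Bool
  xRows = flatten xRow
  yCombinations = flatten yCombination

  xRows-independent-on-y : Independent (λ i q → xRows i (inj₂ q))
  xRows-independent-on-y =
    independent-⊗ (λ l → z (ρ l)) ρ-independent (λ i q → xRows i (inj₂ q)) λ a l c d →
    trans (cong-app (flatten-combine xRow a l) (inj₂ (c , d))) (B-xy (ρ l) a c d)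

  yCombinations-vanish-on-y : ∀ i q → yCombinations i (inj₂ q) ≡ false
  yCombinations-vanish-on-y =
    ∀-flatten {P = λ f → ∀ q → f (inj₂ q) ≡ false} yCombination λ c l q →
    Σ₂-zero λ d → trans (cong (dual l d ∧_) (B-yy (c , d) q)) (∧-zeroʳ (dual l d))

  yCombinations-independent-on-x : Independent (λ i p → yCombinations i (inj₁ p))
  yCombinations-independent-on-x = independent-restrict swap (λ i p → yCombinations i (inj₁ p))
    (independent-⊗ z·dual z·dual-independent (λ i q → yCombinations i (inj₁ (swap q)))
                   yCombination-on-x)
    where
    yCombination-on-x : ∀ c l b a →
                        yCombinations (combine c l) (inj₁ (a , b)) ≡ eqFin c b ∧ z·dual l a
    yCombination-on-x c l b a = begin
      yCombinations (combine c l) (inj₁ (a , b))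
        ≡⟨ cong-app (flatten-combine yCombination c l) (inj₁ (a , b)) ⟩
      Σ₂ (λ d → dual l d ∧ B (inj₂ (c , d)) (inj₁ (a , b)))
        ≡⟨ Σ₂-cong (λ d → trans (cong (dual l d ∧_) (B-yx a b c d))
                                (∧-left-comm (dual l d) (eqFin b c) (z a d))) ⟩
      Σ₂ (λ d → eqFin b c ∧ (dual l d ∧ z a d))
        ≡⟨ Σ₂-∧ˡ (eqFin b c) (λ d → dual l d ∧ z a d) ⟩
      eqFin b c ∧ z·dual l a
        ≡⟨ cong (_∧ z·dual l a) (eqFin-sym b c) ⟩
      eqFin c b ∧ z·dual l a ∎

  generators : Fin (weight w + weight w) → Var n → Bool
  generators = (η ∘ support w) ++ (μ ∘ support w)

  family : Fin (n * r + n * r) → Var n → Bool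
  family = xRows ++ yCombinations

  family-independent : Independent family
  family-independent =
    independent-++ xRows yCombinations
      xRows-independent-on-y yCombinations-vanish-on-y yCombinations-independent-on-x

  family-∈Span : ∀ i → family i ∈Span generators
  family-∈Span = ∀-++ {P = _∈Span generators} xRows yCombinations
    (∀-flatten {P = _∈Span generators} xRow λ a l → polar-row-∈Span μ η w (inj₁ (ρ l , a)))
    (∀-flatten {P = _∈Span generators} yCombination λ c l →
       lincomb-∈Span (λ d → polar-row-∈Span μ η w (inj₂ (c , d))) (dual l))

  rank-bound : n * r ≤ weight w
  rank-bound =
    m+m≤n+n⇒m≤n (independent-∈Span⇒≤ family generators family-independent family-∈Span)

lemma8 : ∀ (n m : ℕ) (μ η : Fin m → LinForm n) (α : Fin m → Mat n) →
    ComputesMatMul μ η α →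
    ((∀ (z w : Mat n) (k : Fin m) → Γ α (z ⊕M w) k ≡ (Γ α z k xor Γ α w k)) ×
     (∀ (c : Bool) (z : Mat n) (k : Fin m) → Γ α (c ·M z) k ≡ (c ∧ Γ α z k))) ×
    (∀ (z : Mat n) (r : ℕ) → Rank z r → n * r ≤ weight (Γ α z))
lemma8 n m μ η α computes =
  (Γ-xor α , Γ-∧ α) ,
  λ z r ((ρ , ρ-independent) , _) → RankBound.rank-bound μ η α computes z ρ ρ-independent
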